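{- Let $G$ be a bipartite graph with maximum degree at most $3$ and no isolated vertices, and let $G_c$ be obtained from $G$ as follows. Let $W$ be the gadget with vertices $a,b,c,d,e,f,g,h,i,j,k$ and edges $ab,ac,bd,be,cf,cg,dh,di,eh,ei,fj,fk,gj,gk,ij,hk$ (with root $a$). For every vertex $u$ of $G$ of degree $2$, add a new copy of $W$ and join its root to $u$; for every vertex $v$ of $G$ of degree $1$, add two new copies of $W$ and join both roots to $v$. Let $x$ and $y$ be the numbers of vertices of $G$ of degree $2$ and degree $1$, respectively. Then $\gamma_t(G)=k$ if and only if $\chi_{cd}(G_c)=k+4x+8y$.
   Context: $\gamma_t(G)$ is the total domination number: the minimum size of a set $S\subseteq V(G)$ such that every vertex of $G$ has a neighbour in $S$. A cd-colouring is a proper vertex colouring in which each colour class is contained in the neighbourhood $N(v)$ of some vertex $v$; $\chi_{cd}$ is the minimum number of colours of a cd-colouring. (The resulting graph $G_c$ is a triangle-free cubic graph.) -}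

module Defs where

open import Data.Nat using (ℕ; zero; suc; _+_; _*_; _≤_)
open import Data.Bool using (Bool; true; false)
open import Data.Fin using (Fin)
open import Data.Fin.Subset using (Subset; _∈_; _∉_; ∣_∣)
open import Data.Vec using (tabulate)
open import Data.List using (List; length)
import Data.List.Membership.Propositional as LM
open import Data.List.Relation.Unary.Unique.Propositional using (Unique)
open import Data.Product using (Σ; ∃; _×_; _,_)
open import Data.Empty using (⊥)
open import Data.Sum using (_⊎_)
open import Relation.Nullary using (¬_; does)
open import Relation.Binary.PropositionalEquality using (_≡_; _≢_)
import Data.Nat as ℕ

record Graph : Set₁ where
  field
    V   : Set
    _~_ : V → V → Set

module _ (G : Graph) where
  open Graph G

  IsTotalDominating : List V → Set
  IsTotalDominating S = ∀ v → ∃ λ w → (w LM.∈ S) × (v ~ w)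

  TotalDominationNumberIs : ℕ → Set
  TotalDominationNumberIs k =
    (∃ λ S → Unique S × IsTotalDominating S × length S ≡ k)
    × (∀ S → Unique S → IsTotalDominating S → k ≤ length S)

  IsCdColouring : (m : ℕ) → (V → Fin m) → Set
  IsCdColouring m c =
    (∀ u v → u ~ v → c u ≢ c v)
    × (∀ (i : Fin m) → ∃ λ v → ∀ w → c w ≡ i → v ~ w)

  CdChromaticNumberIs : ℕ → Set
  CdChromaticNumberIs m =
    (∃ λ (c : V → Fin m) → IsCdColouring m c)
    × (∀ j (c : V → Fin j) → IsCdColouring j c → m ≤ j)

module FinGraph {n : ℕ} (N : Fin n → Subset n) where

  asGraph : Graph
  asGraph = record { V = Fin n ; _~_ = λ u v → v ∈ N u }

  deg : Fin n → ℕ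
  deg u = ∣ N u ∣

  Symmetric : Set
  Symmetric = ∀ u v → v ∈ N u → u ∈ N v

  Irreflexive : Set
  Irreflexive = ∀ u → u ∉ N u

  Bipartite : Set
  Bipartite = ∃ λ (f : Fin n → Bool) → ∀ u v → v ∈ N u → f u ≢ f v

  MaxDegreeAtMost3 : Set
  MaxDegreeAtMost3 = ∀ u → deg u ≤ 3

  NoIsolated : Set
  NoIsolated = ∀ u → 1 ≤ deg u

  numDeg : ℕ → ℕ
  numDeg d = ∣ tabulate (λ u → does (deg u ℕ.≟ d)) ∣

  copies : Fin n → ℕ
  copies u with deg u
  ... | 1 = 2
  ... | 2 = 1
  ... | _ = 0

data Letter : Set where
  a b c d e f g h i j k : Letter

data WEdge : Letter → Letter → Set where
  ab : WEdge a b
  ac : WEdge a c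
  bd : WEdge b d
  be : WEdge b e
  cf : WEdge c f
  cg : WEdge c g
  dh : WEdge d h
  di : WEdge d i
  eh : WEdge e h
  ei : WEdge e i
  fj : WEdge f j
  fk : WEdge f k
  gj : WEdge g j
  gk : WEdge g k
  ij : WEdge i j
  hk : WEdge h k

WAdj : Letter → Letter → Set
WAdj x y = WEdge x y ⊎ WEdge y x

module Construction {n : ℕ} (N : Fin n → Subset n) where
  open FinGraph N

  data CV : Set where
    orig : Fin n → CV
    gad  : (u : Fin n) → Fin (copies u) → Letter → CV

  data _~c_ : CV → CV → Set where
    o-o   : ∀ {u v} → v ∈ N u → orig u ~c orig v
    g-g   : ∀ {u t x y} → WAdj x y → gad u t x ~c gad u t y
    root₁ : ∀ {u t} → orig u ~c gad u t a
    root₂ : ∀ {u t} → gad u t a ~c orig u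

  Gc : Graph
  Gc = record { V = CV ; _~_ = _~c_ }

-- A total dominating set S of G gives a cd-colouring of G_c with |S| + 4g colours, g being the
-- number of copies of W: colour each vertex by a chosen neighbour, taken from S on G and from
-- {b, c, d, f} inside each copy.  As G is bipartite and W has no triangle, adjacent vertices never
-- get the same neighbour, so the colouring is proper.  Conversely, in a cd-colouring every vertex
-- is adjacent to the centre of its colour class.  Inside each copy the centres include two distinct
-- vertices of {b, f, g, h, i} and two of {c, d, e, j, k}; the other centres, once a centre at a
-- root is replaced by a neighbour of the vertex its copy hangs from, totally dominate G.  Hence
-- χ_cd(G_c) = γ_t(G) + 4g, and g = x + 2y.
module Submission where

open import Defs
open import Data.Nat using (ℕ; _+_; _*_)
open import Data.Fin using (Fin)
open import Data.Fin.Subset using (Subset)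
open import Function.Bundles using (_⇔_)

open import Data.Bool using (Bool; true; false; if_then_else_)
open import Data.Bool.Properties using (¬-not; not-injective)
open import Data.Empty using (⊥; ⊥-elim)
open import Data.Fin using (zero; suc)
open import Data.Fin.Patterns using (0F; 1F)
open import Data.Fin.Properties using (+↔⊎; *↔×; injective⇒≤; any?; _≟_)
open import Data.Fin.Subset using (_∈_; ∣_∣; Nonempty)
open import Data.List using (List; length; lookup; filter; allFin)
open import Data.List.Membership.Propositional.Properties using (∈-filter⁺; ∈-filter⁻; ∈-lookup; ∈-allFin)
open import Data.List.Relation.Unary.AllPairs using (_∷_)
import Data.List.Relation.Unary.All as All
import Data.List.Relation.Unary.Any as Any
open import Data.List.Relation.Unary.Any.Properties using (lookup-index)
open import Data.List.Relation.Unary.Unique.Propositional using (Unique)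
import Data.List.Relation.Unary.Unique.Propositional.Properties as Unique
open import Data.Maybe using (Maybe; just; nothing; maybe′)
open import Data.Maybe.Properties using (just-injective; ≡-dec)
open import Data.Nat using (suc; _≤_)
open import Data.Nat.Properties
  using (≤-trans; ≤-antisym; +-cancelʳ-≤; +-monoˡ-≤; +-*-semiring; +-0-commutativeMonoid)
  renaming (_≟_ to _≟ℕ_)
open import Data.Nat.Tactic.RingSolver using (solve-∀)
open import Data.Product using (Σ; ∃; _×_; _,_; proj₁; proj₂)
import Data.Product as Product
open import Data.Product.Function.NonDependent.Propositional using (_×-↔_)
open import Data.Product.Properties using (,-injective; ,-injectiveʳ)
open import Data.Sum using (_⊎_; inj₁; inj₂; [_,_]′)
open import Data.Sum.Function.Propositional using (_⊎-↔_)
open import Data.Vec using (_∷_; tabulate; here; there)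
open import Function using (_∘_; _↔_; Inverse; mk↔ₛ′; mk⇔; Injective)
open import Function.Construct.Composition using (_↔-∘_; _⇔-∘_)
open import Function.Construct.Identity using (↔-id)
open import Function.Construct.Symmetry using (↔-sym; ⇔-sym)
open import Relation.Binary.PropositionalEquality
  using (_≡_; _≢_; refl; sym; trans; cong; cong₂; subst; module ≡-Reasoning)
open import Relation.Nullary using (does)

open import Algebra.Properties.CommutativeMonoid.Sum +-0-commutativeMonoid
  using (sum; sum-cong-≗; ∑-distrib-+)
open import Algebra.Properties.Semiring.Sum +-*-semiring using (*-distribˡ-sum)

Least : (ℕ → Set) → ℕ → Set
Least P n = P n × (∀ {m} → P m → n ≤ m)

least-+ : ∀ {P Q : ℕ → Set} (s : ℕ)
        → (∀ {m} → P m → Q (m + s))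
        → (∀ {j} → Q j → ∃ λ m → P m × m + s ≤ j)
        → ∀ {n} → Least P n ⇔ Least Q (n + s)
least-+ {P} {Q} s P⇒Q Q⇒P {n} = mk⇔ to from
  where
  to : Least P n → Least Q (n + s)
  to (Pn , least) = P⇒Q Pn , λ Qj →
    let (m , Pm , m+s≤j) = Q⇒P Qj in ≤-trans (+-monoˡ-≤ s (least Pm)) m+s≤j

  from : Least Q (n + s) → Least P n
  from (Qn+s , least) =
    let (m , Pm , m+s≤n+s) = Q⇒P Qn+s
    in subst P (≤-antisym (+-cancelʳ-≤ s m n m+s≤n+s) (n≤ Pm)) Pm , n≤
    where
    n≤ : ∀ {m} → P m → n ≤ m
    n≤ Pm = +-cancelʳ-≤ s n _ (least (P⇒Q Pm))

lookup-injective : ∀ {A : Set} {xs : List A} → Unique xs → Injective _≡_ _≡_ (lookup xs)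
lookup-injective (_ ∷ _) {zero} {zero} _ = refl
lookup-injective (x∉xs ∷ _) {zero} {suc q} eq = ⊥-elim (All.lookup x∉xs (∈-lookup q) eq)
lookup-injective (x∉xs ∷ _) {suc p} {zero} eq = ⊥-elim (All.lookup x∉xs (∈-lookup p) (sym eq))
lookup-injective (_ ∷ xs-unique) {suc p} {suc q} eq = cong suc (lookup-injective xs-unique eq)

≤-viaInjection : ∀ {m j} {A : Set} → Fin m ↔ A → (φ : A → Fin j) → Injective _≡_ _≡_ φ → m ≤ j
≤-viaInjection A↔ φ φ-injective = injective⇒≤ λ eq →
  trans (sym (strictlyInverseʳ _)) (trans (cong from (φ-injective eq)) (strictlyInverseʳ _))
  where open Inverse A↔

Σ-suc↔⊎ : ∀ {m} {P : Fin (suc m) → Set} → Σ (Fin (suc m)) P ↔ (P zero ⊎ Σ (Fin m) (P ∘ suc))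
Σ-suc↔⊎ = mk↔ₛ′ (λ { (zero , x) → inj₁ x ; (suc p , x) → inj₂ (p , x) })
                [ (zero ,_) , (λ (p , x) → suc p , x) ]′
                (λ { (inj₁ _) → refl ; (inj₂ _) → refl })
                (λ { (zero , _) → refl ; (suc _ , _) → refl })

sum↔Σ : ∀ {m} (ν : Fin m → ℕ) → Fin (sum ν) ↔ Σ (Fin m) (Fin ∘ ν)
sum↔Σ {0} ν = mk↔ₛ′ (λ ()) (λ { (() , _) }) (λ { (() , _) }) (λ ())
sum↔Σ {suc m} ν = ↔-sym Σ-suc↔⊎ ↔-∘ ((↔-id _ ⊎-↔ sum↔Σ (ν ∘ suc)) ↔-∘ +↔⊎)

∣tabulate∣≡sum : ∀ {m} (p : Fin m → Bool) → ∣ tabulate p ∣ ≡ sum (λ u → if p u then 1 else 0)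
∣tabulate∣≡sum {0} p = refl
∣tabulate∣≡sum {suc m} p with p zero
... | true = cong suc (∣tabulate∣≡sum (p ∘ suc))
... | false = ∣tabulate∣≡sum (p ∘ suc)

size≥1⇒nonempty : ∀ {m} (p : Subset m) → 1 ≤ ∣ p ∣ → Nonempty p
size≥1⇒nonempty (true ∷ p) _ = zero , here
size≥1⇒nonempty (false ∷ p) 1≤∣p∣ = Product.map suc there (size≥1⇒nonempty p 1≤∣p∣)

module _ (G : Graph) where
  open Graph G

  HasTotalDominatingSet : ℕ → Set
  HasTotalDominatingSet m = ∃ λ S → Unique S × IsTotalDominating G S × length S ≡ m

  HasCdColouring : ℕ → Set
  HasCdColouring m = ∃ (IsCdColouring G m)

  totalDominationNumber⇔least : ∀ {m} → TotalDominationNumberIs G m ⇔ Least HasTotalDominatingSet m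
  totalDominationNumber⇔least = mk⇔
    (λ (S , least) → S , λ { (S′ , u , t , refl) → least S′ u t })
    (λ (S , least) → S , λ S′ u t → least (S′ , u , t , refl))

  cdChromaticNumber⇔least : ∀ {m} → CdChromaticNumberIs G m ⇔ Least HasCdColouring m
  cdChromaticNumber⇔least = mk⇔
    (λ (col , least) → col , λ (col′ , cd) → least _ col′ cd)
    (λ (col , least) → col , λ _ col′ cd → least (col′ , cd))

  cdColouring-viaCentres : ∀ {m} {A : Set} (A↔ : Fin m ↔ A) (colour : V → A) (centre : A → V)
    → (∀ w → centre (colour w) ~ w)
    → (∀ {u v} → u ~ v → centre (colour u) ≢ centre (colour v))
    → IsCdColouring G m (Inverse.from A↔ ∘ colour)
  cdColouring-viaCentres A↔ colour centre adjacent proper =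
      (λ u v u~v eq → proper u~v (cong centre (from-injective eq)))
    , λ q → centre (to q) , λ w eq →
        subst (λ x → centre x ~ w) (trans (sym (strictlyInverseˡ _)) (cong to eq)) (adjacent w)
    where
    open Inverse A↔
    from-injective : Injective _≡_ _≡_ from
    from-injective eq = trans (sym (strictlyInverseˡ _)) (trans (cong to eq) (strictlyInverseˡ _))

half : Letter → Maybe (Fin 2)
half a = nothing
half b = just 0F
half c = just 1F
half d = just 1F
half e = just 1F
half f = just 0F
half g = just 0F
half h = just 0F
half i = just 0F
half j = just 1F
half k = just 1F

GadgetColour : Set
GadgetColour = Fin 2 × Fin 2

wCentre : GadgetColour → Letter
wCentre (0F , 0F) = b
wCentre (0F , 1F) = f
wCentre (1F , 0F) = c
wCentre (1F , 1F) = d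

wDominator : Letter → GadgetColour
wDominator a = 0F , 0F
wDominator b = 1F , 1F
wDominator c = 0F , 1F
wDominator d = 0F , 0F
wDominator e = 0F , 0F
wDominator f = 1F , 0F
wDominator g = 1F , 0F
wDominator h = 1F , 1F
wDominator i = 1F , 1F
wDominator j = 0F , 1F
wDominator k = 0F , 1F

wDominator-adj : ∀ x → WAdj (wCentre (wDominator x)) x
wDominator-adj a = inj₂ ab
wDominator-adj b = inj₂ bd
wDominator-adj c = inj₂ cf
wDominator-adj d = inj₁ bd
wDominator-adj e = inj₁ be
wDominator-adj f = inj₁ cf
wDominator-adj g = inj₁ cg
wDominator-adj h = inj₁ dh
wDominator-adj i = inj₁ di
wDominator-adj j = inj₁ fj
wDominator-adj k = inj₁ fk

wDominator-properOnEdges : ∀ {x y} → WEdge x y → wCentre (wDominator x) ≢ wCentre (wDominator y)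
wDominator-properOnEdges ab ()
wDominator-properOnEdges ac ()
wDominator-properOnEdges bd ()
wDominator-properOnEdges be ()
wDominator-properOnEdges cf ()
wDominator-properOnEdges cg ()
wDominator-properOnEdges dh ()
wDominator-properOnEdges di ()
wDominator-properOnEdges eh ()
wDominator-properOnEdges ei ()
wDominator-properOnEdges fj ()
wDominator-properOnEdges fk ()
wDominator-properOnEdges gj ()
wDominator-properOnEdges gk ()
wDominator-properOnEdges ij ()
wDominator-properOnEdges hk ()

wDominator-proper : ∀ {x y} → WAdj x y → wCentre (wDominator x) ≢ wCentre (wDominator y)
wDominator-proper (inj₁ xy) = wDominator-properOnEdges xy
wDominator-proper (inj₂ yx) = wDominator-properOnEdges yx ∘ sym

DominatedBy : (Letter → Set) → Letter → Set
DominatedBy P x = ∃ λ y → WAdj y x × P y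

record HalfPair (P : Letter → Set) (s : Fin 2) : Set where
  constructor halfPair
  field
    fst snd  : Letter
    fst≢snd  : fst ≢ snd
    half-fst : half fst ≡ just s
    half-snd : half snd ≡ just s
    P-fst    : P fst
    P-snd    : P snd

  pick : Fin 2 → Letter
  pick 0F = fst
  pick 1F = snd

  pick-injective : Injective _≡_ _≡_ pick
  pick-injective {0F} {0F} _ = refl
  pick-injective {0F} {1F} eq = ⊥-elim (fst≢snd eq)
  pick-injective {1F} {0F} eq = ⊥-elim (fst≢snd (sym eq))
  pick-injective {1F} {1F} _ = refl

  pick-half : ∀ r → half (pick r) ≡ just s
  pick-half 0F = half-fst
  pick-half 1F = half-snd

  pick-P : ∀ r → P (pick r)
  pick-P 0F = P-fst
  pick-P 1F = P-snd

-- N(d), N(j), N(k) lie in half 0 and N(f), N(h), N(i) in half 1, and no vertex lies in all three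
-- neighbourhoods of a triple, so each triple needs two distinct dominators.
halfPair₀ : ∀ {P} → DominatedBy P d → DominatedBy P j → DominatedBy P k → HalfPair P 0F
halfPair₀ (_ , inj₁ bd , Pb) (_ , inj₁ fj , Pf) _ = halfPair b f (λ ()) refl refl Pb Pf
halfPair₀ (_ , inj₁ bd , Pb) (_ , inj₁ gj , Pg) _ = halfPair b g (λ ()) refl refl Pb Pg
halfPair₀ (_ , inj₁ bd , Pb) (_ , inj₁ ij , Pi) _ = halfPair b i (λ ()) refl refl Pb Pi
halfPair₀ (_ , inj₂ dh , Ph) (_ , inj₁ fj , Pf) _ = halfPair h f (λ ()) refl refl Ph Pf
halfPair₀ (_ , inj₂ dh , Ph) (_ , inj₁ gj , Pg) _ = halfPair h g (λ ()) refl refl Ph Pg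
halfPair₀ (_ , inj₂ dh , Ph) (_ , inj₁ ij , Pi) _ = halfPair h i (λ ()) refl refl Ph Pi
halfPair₀ (_ , inj₂ di , Pi) _ (_ , inj₁ fk , Pf) = halfPair i f (λ ()) refl refl Pi Pf
halfPair₀ (_ , inj₂ di , Pi) _ (_ , inj₁ gk , Pg) = halfPair i g (λ ()) refl refl Pi Pg
halfPair₀ (_ , inj₂ di , Pi) _ (_ , inj₁ hk , Ph) = halfPair i h (λ ()) refl refl Pi Ph

halfPair₁ : ∀ {P} → DominatedBy P f → DominatedBy P h → DominatedBy P i → HalfPair P 1F
halfPair₁ (_ , inj₁ cf , Pc) (_ , inj₁ dh , Pd) _ = halfPair c d (λ ()) refl refl Pc Pd
halfPair₁ (_ , inj₁ cf , Pc) (_ , inj₁ eh , Pe) _ = halfPair c e (λ ()) refl refl Pc Pe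
halfPair₁ (_ , inj₁ cf , Pc) (_ , inj₂ hk , Pk) _ = halfPair c k (λ ()) refl refl Pc Pk
halfPair₁ (_ , inj₂ fj , Pj) (_ , inj₁ dh , Pd) _ = halfPair j d (λ ()) refl refl Pj Pd
halfPair₁ (_ , inj₂ fj , Pj) (_ , inj₁ eh , Pe) _ = halfPair j e (λ ()) refl refl Pj Pe
halfPair₁ (_ , inj₂ fj , Pj) (_ , inj₂ hk , Pk) _ = halfPair j k (λ ()) refl refl Pj Pk
halfPair₁ (_ , inj₂ fk , Pk) _ (_ , inj₁ di , Pd) = halfPair k d (λ ()) refl refl Pk Pd
halfPair₁ (_ , inj₂ fk , Pk) _ (_ , inj₁ ei , Pe) = halfPair k e (λ ()) refl refl Pk Pe
halfPair₁ (_ , inj₂ fk , Pk) _ (_ , inj₂ ij , Pj) = halfPair k j (λ ()) refl refl Pk Pj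

module FourCentres {P : Letter → Set} (dominated : ∀ x → x ≢ a → DominatedBy P x) where

  halfPairs : ∀ s → HalfPair P s
  halfPairs 0F = halfPair₀ (dominated d λ ()) (dominated j λ ()) (dominated k λ ())
  halfPairs 1F = halfPair₁ (dominated f λ ()) (dominated h λ ()) (dominated i λ ())

  centre : GadgetColour → Letter
  centre (s , r) = HalfPair.pick (halfPairs s) r

  centre-half : ∀ x → half (centre x) ≡ just (proj₁ x)
  centre-half (s , r) = HalfPair.pick-half (halfPairs s) r

  centre-P : ∀ x → P (centre x)
  centre-P (s , r) = HalfPair.pick-P (halfPairs s) r

  centre-injective : Injective _≡_ _≡_ centre
  centre-injective {s , r} {s′ , r′} eq
    with just-injective (trans (sym (centre-half (s , r))) (trans (cong half eq) (centre-half (s′ , r′))))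
  ... | refl = cong (s ,_) (HalfPair.pick-injective (halfPairs s) eq)

module _ {n : ℕ} (N : Fin n → Subset n) where
  open FinGraph N
  open Construction N

  Copy : Set
  Copy = Σ (Fin n) (Fin ∘ copies)

  degreeIs : ℕ → Fin n → ℕ
  degreeIs δ u = if does (deg u ≟ℕ δ) then 1 else 0

  copies≡ : ∀ u → copies u ≡ degreeIs 2 u + 2 * degreeIs 1 u
  copies≡ u with deg u
  ... | 0 = refl
  ... | 1 = refl
  ... | 2 = refl
  ... | suc (suc (suc _)) = refl

  numDeg≡sum : ∀ δ → numDeg δ ≡ sum (degreeIs δ)
  numDeg≡sum δ = ∣tabulate∣≡sum (λ u → does (deg u ≟ℕ δ))

  sum-copies : sum copies ≡ numDeg 2 + 2 * numDeg 1
  sum-copies = begin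
    sum copies
      ≡⟨ sum-cong-≗ copies≡ ⟩
    sum (λ u → degreeIs 2 u + 2 * degreeIs 1 u)
      ≡⟨ ∑-distrib-+ (degreeIs 2) _ ⟩
    sum (degreeIs 2) + sum (λ u → 2 * degreeIs 1 u)
      ≡⟨ cong (sum (degreeIs 2) +_) (sym (*-distribˡ-sum 2 (degreeIs 1))) ⟩
    sum (degreeIs 2) + 2 * sum (degreeIs 1)
      ≡⟨ sym (cong₂ (λ x y → x + 2 * y) (numDeg≡sum 2) (numDeg≡sum 1)) ⟩
    numDeg 2 + 2 * numDeg 1
      ∎
    where open ≡-Reasoning

  colourCount : ∀ γ → γ + 4 * numDeg 2 + 8 * numDeg 1 ≡ γ + 4 * sum copies
  colourCount γ = trans (expand γ (numDeg 2) (numDeg 1)) (cong (λ x → γ + 4 * x) (sym sum-copies))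
    where
    expand : ∀ γ x y → γ + 4 * x + 8 * y ≡ γ + 4 * (x + 2 * y)
    expand = solve-∀

  colours↔ : ∀ s → Fin (s + 4 * sum copies) ↔ (Fin s ⊎ GadgetColour × Copy)
  colours↔ s = (↔-id _ ⊎-↔ ((*↔× ×-↔ sum↔Σ copies) ↔-∘ *↔×)) ↔-∘ +↔⊎

  bipartite⇒noTriangle : Bipartite → ∀ {u v w} → v ∈ N u → w ∈ N u → w ∈ N v → ⊥
  bipartite⇒noTriangle (_ , proper) {u} {v} {w} v∈Nu w∈Nu w∈Nv =
    proper v w w∈Nv (not-injective (trans (sym (¬-not (proper u v v∈Nu))) (¬-not (proper u w w∈Nu))))

  orig-injective : ∀ {u v} → orig u ≡ orig v → u ≡ v
  orig-injective refl = refl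

  gad-injective : ∀ {u u′ t t′ l l′} → gad u t l ≡ gad u′ t′ l′ → ((u , t) , l) ≡ ((u′ , t′) , l′)
  gad-injective refl = refl

  gad-neighbour : ∀ {y u t x} → x ≢ a → y ~c gad u t x → ∃ λ l → WAdj l x × y ≡ gad u t l
  gad-neighbour _ (g-g l~x) = _ , l~x , refl
  gad-neighbour x≢a root₁ = ⊥-elim (x≢a refl)

  module UpperBound (symmetric : Symmetric) (bipartite : Bipartite)
                    (S : List (Fin n)) (dominating : IsTotalDominating asGraph S) where

    dominator : Fin n → Fin n
    dominator v = proj₁ (dominating v)

    dominator∈N : ∀ v → dominator v ∈ N v
    dominator∈N v = proj₂ (proj₂ (dominating v))

    Colour : Set
    Colour = Fin (length S) ⊎ GadgetColour × Copy

    colour : CV → Colour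
    colour (orig v) = inj₁ (Any.index (proj₁ (proj₂ (dominating v))))
    colour (gad u t x) = inj₂ (wDominator x , u , t)

    centre : Colour → CV
    centre (inj₁ p) = orig (lookup S p)
    centre (inj₂ (r , u , t)) = gad u t (wCentre r)

    centre-orig : ∀ v → centre (colour (orig v)) ≡ orig (dominator v)
    centre-orig v = cong orig (sym (lookup-index (proj₁ (proj₂ (dominating v)))))

    centre-adj : ∀ w → centre (colour w) ~c w
    centre-adj (orig v) rewrite centre-orig v = o-o (symmetric v _ (dominator∈N v))
    centre-adj (gad u t x) = g-g (wDominator-adj x)

    centre-proper : ∀ {w w′} → w ~c w′ → centre (colour w) ≢ centre (colour w′)
    centre-proper (o-o {u} {v} v∈Nu) eq =
      bipartite⇒noTriangle bipartite v∈Nu (dominator∈N u) (subst (_∈ N v) (sym same) (dominator∈N v))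
      where
      same : dominator u ≡ dominator v
      same = orig-injective (trans (sym (centre-orig u)) (trans eq (centre-orig v)))
    centre-proper root₁ ()
    centre-proper root₂ ()
    centre-proper (g-g x~y) eq = wDominator-proper x~y (,-injectiveʳ (gad-injective eq))

    cdColouring : HasCdColouring Gc (length S + 4 * sum copies)
    cdColouring =
      _ , cdColouring-viaCentres Gc (colours↔ (length S)) colour centre centre-adj centre-proper

  module LowerBound (symmetric : Symmetric) (noIsolated : NoIsolated)
                    {j : ℕ} (col : CV → Fin j) (cd : IsCdColouring Gc j col) where

    neighbour : Fin n → Fin n
    neighbour u = proj₁ (size≥1⇒nonempty (N u) (noIsolated u))

    -- A centre at a root is traded for a neighbour of the vertex its gadget hangs from: both
    -- dominate that vertex.
    vertexShadow : CV → Maybe (Fin n)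
    vertexShadow (orig w) = just w
    vertexShadow (gad u _ l) = maybe′ (λ _ → nothing) (just (neighbour u)) (half l)

    vertexShadow-adj : ∀ {y v} → y ~c orig v → ∃ λ w → vertexShadow y ≡ just w × w ∈ N v
    vertexShadow-adj (o-o {w} {v} v∈Nw) = w , refl , symmetric w v v∈Nw
    vertexShadow-adj (root₂ {v}) = neighbour v , refl , proj₂ (size≥1⇒nonempty (N v) (noIsolated v))

    centre : Fin j → CV
    centre q = proj₁ (proj₂ cd q)

    centre-adj : ∀ w → centre (col w) ~c w
    centre-adj w = proj₂ (proj₂ cd (col w)) w refl

    S : List (Fin n)
    S = filter (λ v → any? λ q → ≡-dec _≟_ (vertexShadow (centre q)) (just v)) (allFin n)

    S-unique : Unique S
    S-unique = Unique.filter⁺ _ (Unique.allFin⁺ n)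

    S-dominating : IsTotalDominating asGraph S
    S-dominating v =
      let (w , shadow≡w , w∈Nv) = vertexShadow-adj (centre-adj (orig v))
      in w , ∈-filter⁺ _ (∈-allFin w) (col (orig v) , shadow≡w) , w∈Nv

    vertexColour : Fin (length S) → Fin j
    vertexColour p = proj₁ (proj₂ (∈-filter⁻ _ {xs = allFin n} (∈-lookup p)))

    colourShadow : Fin j → Maybe (Fin n)
    colourShadow = vertexShadow ∘ centre

    vertexColour-shadow : ∀ p → colourShadow (vertexColour p) ≡ just (lookup S p)
    vertexColour-shadow p = proj₂ (proj₂ (∈-filter⁻ _ {xs = allFin n} (∈-lookup p)))

    IsCentreIn : Copy → Letter → Set
    IsCentreIn (u , t) l = ∃ λ q → centre q ≡ gad u t l

    gadget-dominated : ∀ cp x → x ≢ a → DominatedBy (IsCentreIn cp) x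
    gadget-dominated (u , t) x x≢a =
      let (l , l~x , centre≡) = gad-neighbour x≢a (centre-adj (gad u t x))
      in l , l~x , col (gad u t x) , centre≡

    module Centres (cp : Copy) = FourCentres (gadget-dominated cp)

    gadgetColour : GadgetColour × Copy → Fin j
    gadgetColour (r , cp) = proj₁ (Centres.centre-P cp r)

    gadgetColour-centre : ∀ r cp
                        → centre (gadgetColour (r , cp)) ≡ gad (proj₁ cp) (proj₂ cp) (Centres.centre cp r)
    gadgetColour-centre r cp = proj₂ (Centres.centre-P cp r)

    gadgetColour-shadow : ∀ x → colourShadow (gadgetColour x) ≡ nothing
    gadgetColour-shadow (r , cp) rewrite gadgetColour-centre r cp | Centres.centre-half cp r = refl

    gadgetColour-injective : Injective _≡_ _≡_ gadgetColour
    gadgetColour-injective {r , cp} {r′ , cp′} eq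
      with ,-injective (gad-injective (trans (sym (gadgetColour-centre r cp))
                                         (trans (cong centre eq) (gadgetColour-centre r′ cp′))))
    ... | refl , same-centre = cong (_, cp) (Centres.centre-injective cp same-centre)

    colourInjection : Fin (length S) ⊎ GadgetColour × Copy → Fin j
    colourInjection = [ vertexColour , gadgetColour ]′

    vertexColour≢gadgetColour : ∀ p x → vertexColour p ≢ gadgetColour x
    vertexColour≢gadgetColour p x eq
      with trans (sym (vertexColour-shadow p)) (trans (cong colourShadow eq) (gadgetColour-shadow x))
    ... | ()

    colourInjection-injective : Injective _≡_ _≡_ colourInjection
    colourInjection-injective {inj₁ p} {inj₁ p′} eq = cong inj₁ (lookup-injective S-unique (just-injective
      (trans (sym (vertexColour-shadow p)) (trans (cong colourShadow eq) (vertexColour-shadow p′)))))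
    colourInjection-injective {inj₁ p} {inj₂ x} eq = ⊥-elim (vertexColour≢gadgetColour p x eq)
    colourInjection-injective {inj₂ x} {inj₁ p} eq = ⊥-elim (vertexColour≢gadgetColour p x (sym eq))
    colourInjection-injective {inj₂ x} {inj₂ x′} eq = cong inj₂ (gadgetColour-injective eq)

    lowerBound : ∃ λ m → HasTotalDominatingSet asGraph m × m + 4 * sum copies ≤ j
    lowerBound = length S , (S , S-unique , S-dominating , refl)
               , ≤-viaInjection (colours↔ (length S)) colourInjection colourInjection-injective

lemma1 : ∀ {n : ℕ} (N : Fin n → Subset n)
         → FinGraph.Symmetric N
         → FinGraph.Irreflexive N
         → FinGraph.Bipartite N
         → FinGraph.MaxDegreeAtMost3 N
         → FinGraph.NoIsolated N
         → ∀ (k : ℕ)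
         → TotalDominationNumberIs (FinGraph.asGraph N) k
           ⇔ CdChromaticNumberIs (Construction.Gc N)
               (k + 4 * FinGraph.numDeg N 2 + 8 * FinGraph.numDeg N 1)
lemma1 N symmetric _ bipartite _ noIsolated γ =
  subst (λ m → TotalDominationNumberIs G γ ⇔ CdChromaticNumberIs Gc m) (sym (colourCount N γ))
    (⇔-sym (cdChromaticNumber⇔least Gc)
      ⇔-∘ (least-+ gadgetColours upper lower ⇔-∘ totalDominationNumber⇔least G))
  where
  G : Graph
  G = FinGraph.asGraph N

  Gc : Graph
  Gc = Construction.Gc N

  gadgetColours : ℕ
  gadgetColours = 4 * sum (FinGraph.copies N)

  upper : ∀ {m} → HasTotalDominatingSet G m → HasCdColouring Gc (m + gadgetColours)
  upper (S , _ , dominating , refl) = UpperBound.cdColouring N symmetric bipartite S dominating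

  lower : ∀ {j} → HasCdColouring Gc j → ∃ λ m → HasTotalDominatingSet G m × m + gadgetColours ≤ j
  lower (col , cd) = LowerBound.lowerBound N symmetric noIsolated col cd
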